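{- Let $i,j,k$ be nonnegative integers and $N\ge1$ an integer. Then \[ \pi_N\bigl(Q^{Nk}_{Ni,Nj}\bigr)=N\,Q^k_{i,j}. \]
   Context: Here $\mathbb{R}^\infty$ denotes the space of real sequences with finitely many nonzero entries. For nonnegative integers $i,j,k$ with $r:=i+j-k$, define \[ Q^k_{i,j}=\Bigl\{x\in\mathbb{R}^\infty_{\ge0}:\ \sum_{m\ge1}x_m=r,\ \ \sum_{m=1}^{\ell}x_m\le\ell\ \text{for }1\le\ell\le i,\ \ x_m=0\ \text{for }m>k\Bigr\}, \] and $NQ=\{Nx:x\in Q\}$. The linear map $\pi_N:\mathbb{R}^\infty\to\mathbb{R}^\infty$ is $\pi_N(x_1,x_2,\dots)=\bigl(\sum_{m=1}^Nx_m,\ \sum_{m=N+1}^{2N}x_m,\ \sum_{m=2N+1}^{3N}x_m,\dots\bigr)$. -}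

module Defs where

open import Level using (0ℓ)
open import Data.Nat as ℕ using (ℕ; zero; suc)
open import Data.Product using (Σ; ∃; ∃-syntax; _×_; _,_)
open import Relation.Nullary using (¬_)
open import Relation.Binary.PropositionalEquality using (_≡_)
open import Relation.Binary.Structures using (IsTotalOrder)
open import Algebra.Structures using (IsCommutativeRing)

-- The real numbers, axiomatised as a Dedekind-complete ordered field
-- (unique up to isomorphism classically).  Equality is propositional.
record RealField : Set₁ where
  infixl 6 _+_ _-_
  infixl 7 _*_
  infix 4 _≤_
  field
    Carrier : Set
    _+_ _*_ : Carrier → Carrier → Carrier
    -_      : Carrier → Carrier
    0# 1#   : Carrier
    _≤_     : Carrier → Carrier → Set
    isCommutativeRing : IsCommutativeRing _≡_ _+_ _*_ -_ 0# 1#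
    0≢1     : ¬ (0# ≡ 1#)
    inverse : ∀ x → ¬ (x ≡ 0#) → ∃[ y ] (x * y ≡ 1#)
    isTotalOrder : IsTotalOrder _≡_ _≤_
    +-mono-≤ : ∀ {x y} z → x ≤ y → x + z ≤ y + z
    *-nonneg : ∀ {x y} → 0# ≤ x → 0# ≤ y → 0# ≤ x * y
    sup : (S : Carrier → Set) → ∃[ a ] S a → ∃[ b ] (∀ x → S x → x ≤ b) →
          ∃[ s ] ((∀ x → S x → x ≤ s) × (∀ b → (∀ x → S x → x ≤ b) → s ≤ b))

  _-_ : Carrier → Carrier → Carrier
  x - y = x + (- y)

  fromℕ : ℕ → Carrier
  fromℕ zero    = 0#
  fromℕ (suc n) = 1# + fromℕ n

  sumTo : (ℕ → Carrier) → ℕ → Carrier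
  sumTo f zero    = 0#
  sumTo f (suc n) = sumTo f n + f n

module _ (ℝ : RealField) where
  open RealField ℝ

  -- ℝ^∞ : real sequences with finitely many nonzero entries.
  -- 0-indexed: the function value at m is the paper's x_{m+1}.
  Seq : Set
  Seq = Σ (ℕ → Carrier) λ x → ∃[ n ] (∀ m → n ℕ.≤ m → x m ≡ 0#)

  total : Seq → Carrier
  total (x , n , _) = sumTo x n

  Q : ℕ → ℕ → ℕ → Seq → Set
  Q k i j s@(x , _) =
      (∀ m → 0# ≤ x m)
    × (total s ≡ fromℕ (i ℕ.+ j) - fromℕ k)
    × (∀ ℓ → 1 ℕ.≤ ℓ → ℓ ℕ.≤ i → sumTo x ℓ ≤ fromℕ ℓ)
    × (∀ m → k ℕ.≤ m → x m ≡ 0#)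

  πcoord : ℕ → Seq → ℕ → Carrier
  πcoord N (x , _) p = sumTo (λ t → x (p ℕ.* N ℕ.+ t)) N

  InImageπ : ℕ → (Seq → Set) → Seq → Set
  InImageπ N A (y , _) = ∃[ z ] (A z × (∀ p → y p ≡ πcoord N z p))

  InScaled : ℕ → (Seq → Set) → Seq → Set
  InScaled N A (y , _) = ∃[ x ] (A x × (∀ p → y p ≡ fromℕ N * Seq-val x p))
    where
    Seq-val : Seq → ℕ → Carrier
    Seq-val (f , _) = f

module Submission where

-- Summing z ∈ Q^{Nk}_{Ni,Nj} over blocks of length N turns its prefix sums at multiples of N into
-- the prefix sums of π_N z, so π_N z / N lies in Q^k_{i,j}. Conversely, x ∈ Q^k_{i,j} is π_N / N applied to
-- the sequence repeating every entry of x N times. A prefix of length qN + s (s ≤ N) of that sequence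
-- sums to N S_q + s x_q = (N - s) S_q + s S_{q+1}, where S are the prefix sums of x; this convex
-- combination of the bounds S_q ≤ q and S_{q+1} ≤ q + 1 is at most qN + s.

open import Defs
open import Level using (0ℓ)
open import Algebra.Bundles using (CommutativeRing)
open import Algebra.Structures using (IsCommutativeRing)
open import Data.Empty using (⊥-elim)
open import Data.Maybe using (nothing)
open import Data.Nat as ℕ using (ℕ; zero; suc; NonZero; _/_; _%_)
import Data.Nat.Properties as ℕₚ
open import Data.Nat.DivMod
  using (m≡m%n+[m/n]*n; m/n*n≤m; m%n<n; +-distrib-/-∣ˡ; m*n/n≡m; m<n⇒m/n≡0; /-monoˡ-≤)
open import Data.Nat.Divisibility using (divides)
import Data.Nat.Tactic.RingSolver as ℕ-Solver
open import Data.Product using (_,_; proj₁; proj₂)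
open import Data.Sum using (inj₁; inj₂)
open import Function.Bundles using (mk⇔)
open import Relation.Binary.Bundles using (Poset)
open import Relation.Binary.PropositionalEquality
  using (_≡_; refl; sym; trans; cong; cong₂; subst; subst₂; module ≡-Reasoning)
open import Relation.Binary.Structures using (IsTotalOrder)
open import Relation.Nullary using (¬_)
open import Tactic.RingSolver.Core.AlmostCommutativeRing using (fromCommutativeRing)

[m*n+o]/n≡m : ∀ m {n o} .{{_ : NonZero n}} → o ℕ.< n → (m ℕ.* n ℕ.+ o) / n ≡ m
[m*n+o]/n≡m m {n} {o} o<n = begin
  (m ℕ.* n ℕ.+ o) / n ≡⟨ +-distrib-/-∣ˡ o (divides m refl) ⟩
  m ℕ.* n / n ℕ.+ o / n ≡⟨ cong₂ ℕ._+_ (m*n/n≡m m n) (m<n⇒m/n≡0 o<n) ⟩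
  m ℕ.+ 0              ≡⟨ ℕₚ.+-identityʳ m ⟩
  m                    ∎
  where open ≡-Reasoning

m*n≤o⇒m≤o/n : ∀ m {n o} .{{_ : NonZero n}} → m ℕ.* n ℕ.≤ o → m ℕ.≤ o / n
m*n≤o⇒m≤o/n m {n} {o} le = subst (ℕ._≤ o / n) (m*n/n≡m m n) (/-monoˡ-≤ n le)

module _ (ℝ : RealField) where
  open RealField ℝ renaming (+-mono-≤ to +-monoˡ-≤)
  open IsCommutativeRing isCommutativeRing
    using ( +-assoc; +-comm; +-identityˡ; +-identityʳ; -‿inverseˡ; -‿inverseʳ
          ; *-assoc; *-comm; *-identityˡ; zeroˡ; zeroʳ; distribˡ; distribʳ)
  open IsTotalOrder isTotalOrder using (antisym) renaming (refl to ≤-refl; trans to ≤-trans; total to ≤-total)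

  commutativeRing : CommutativeRing 0ℓ 0ℓ
  commutativeRing = record { isCommutativeRing = isCommutativeRing }

  poset : Poset 0ℓ 0ℓ 0ℓ
  poset = record { isPartialOrder = IsTotalOrder.isPartialOrder isTotalOrder }

  open import Algebra.Properties.Ring (CommutativeRing.ring commutativeRing)
    using (-‿distribˡ-*; -‿distribʳ-*; x[y-z]≈xy-xz; -‿involutive)
  open import Algebra.Properties.Group (CommutativeRing.+-group commutativeRing)
    using (//-rightDividesˡ)
  open import Tactic.RingSolver.NonReflective (fromCommutativeRing commutativeRing (λ _ → nothing))
    using (solve; _⊜_; _⊕_; _⊗_)
  import Relation.Binary.Reasoning.PartialOrder poset as ≤-Reasoning

  +-monoʳ-≤ : ∀ z {x y} → x ≤ y → z + x ≤ z + y
  +-monoʳ-≤ z {x} {y} x≤y = subst₂ _≤_ (+-comm x z) (+-comm y z) (+-monoˡ-≤ z x≤y)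

  +-mono-≤ : ∀ {x y u v} → x ≤ y → u ≤ v → x + u ≤ y + v
  +-mono-≤ {y = y} {u} x≤y u≤v = ≤-trans (+-monoˡ-≤ u x≤y) (+-monoʳ-≤ y u≤v)

  x≤y⇒0≤y-x : ∀ {x y} → x ≤ y → 0# ≤ y - x
  x≤y⇒0≤y-x {x} x≤y = subst (_≤ _) (-‿inverseʳ x) (+-monoˡ-≤ (- x) x≤y)

  0≤y-x⇒x≤y : ∀ {x y} → 0# ≤ y - x → x ≤ y
  0≤y-x⇒x≤y {x} {y} 0≤y-x = subst₂ _≤_ (+-identityˡ x) (//-rightDividesˡ x y) (+-monoˡ-≤ x 0≤y-x)

  x≤0⇒0≤-x : ∀ {x} → x ≤ 0# → 0# ≤ - x
  x≤0⇒0≤-x {x} x≤0 = subst₂ _≤_ (-‿inverseʳ x) (+-identityˡ (- x)) (+-monoˡ-≤ (- x) x≤0)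

  0≤-x⇒x≤0 : ∀ {x} → 0# ≤ - x → x ≤ 0#
  0≤-x⇒x≤0 {x} 0≤-x = subst₂ _≤_ (+-identityˡ x) (-‿inverseˡ x) (+-monoˡ-≤ x 0≤-x)

  *-monoʳ-≤-nonNeg : ∀ {z x y} → 0# ≤ z → x ≤ y → z * x ≤ z * y
  *-monoʳ-≤-nonNeg {z} {x} {y} 0≤z x≤y =
    0≤y-x⇒x≤y (subst (0# ≤_) (x[y-z]≈xy-xz z y x) (*-nonneg 0≤z (x≤y⇒0≤y-x x≤y)))

  x≤0⇒0≤x*x : ∀ {x} → x ≤ 0# → 0# ≤ x * x
  x≤0⇒0≤x*x {x} x≤0 = subst (0# ≤_) [-x]*[-x]≡x*x (*-nonneg 0≤-x 0≤-x)
    where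
    0≤-x : 0# ≤ - x
    0≤-x = x≤0⇒0≤-x x≤0
    [-x]*[-x]≡x*x : (- x) * (- x) ≡ x * x
    [-x]*[-x]≡x*x = begin
      (- x) * (- x)   ≡⟨ -‿distribʳ-* (- x) x ⟨
      - ((- x) * x)   ≡⟨ cong -_ (-‿distribˡ-* x x) ⟨
      - (- (x * x))   ≡⟨ -‿involutive (x * x) ⟩
      x * x           ∎
      where open ≡-Reasoning

  0≤1 : 0# ≤ 1#
  0≤1 with ≤-total 0# 1#
  ... | inj₁ 0≤1 = 0≤1
  ... | inj₂ 1≤0 = subst (0# ≤_) (*-identityˡ 1#) (x≤0⇒0≤x*x 1≤0)

  ¬1≤0 : ¬ (1# ≤ 0#)
  ¬1≤0 1≤0 = 0≢1 (antisym 0≤1 1≤0)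

  -- If c were negative, a * c = 1 would force 1 ≤ 0.
  *-inverse-nonNeg : ∀ {a c} → 0# ≤ a → a * c ≡ 1# → 0# ≤ c
  *-inverse-nonNeg {a} {c} 0≤a ac≡1 with ≤-total 0# c
  ... | inj₁ 0≤c = 0≤c
  ... | inj₂ c≤0 = ⊥-elim (¬1≤0 (0≤-x⇒x≤0 (subst (0# ≤_) a*[-c]≡-1 (*-nonneg 0≤a (x≤0⇒0≤-x c≤0)))))
    where
    a*[-c]≡-1 : a * (- c) ≡ - 1#
    a*[-c]≡-1 = trans (sym (-‿distribʳ-* a c)) (cong -_ ac≡1)

  fromℕ-+ : ∀ m n → fromℕ (m ℕ.+ n) ≡ fromℕ m + fromℕ n
  fromℕ-+ zero    n = sym (+-identityˡ (fromℕ n))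
  fromℕ-+ (suc m) n = trans (cong (1# +_) (fromℕ-+ m n)) (sym (+-assoc 1# (fromℕ m) (fromℕ n)))

  fromℕ-* : ∀ m n → fromℕ (m ℕ.* n) ≡ fromℕ m * fromℕ n
  fromℕ-* zero    n = sym (zeroˡ (fromℕ n))
  fromℕ-* (suc m) n = begin
    fromℕ (n ℕ.+ m ℕ.* n)              ≡⟨ fromℕ-+ n (m ℕ.* n) ⟩
    fromℕ n + fromℕ (m ℕ.* n)          ≡⟨ cong (fromℕ n +_) (fromℕ-* m n) ⟩
    fromℕ n + fromℕ m * fromℕ n        ≡⟨ cong (_+ fromℕ m * fromℕ n) (*-identityˡ (fromℕ n)) ⟨
    1# * fromℕ n + fromℕ m * fromℕ n   ≡⟨ distribʳ (fromℕ n) 1# (fromℕ m) ⟨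
    (1# + fromℕ m) * fromℕ n           ∎
    where open ≡-Reasoning

  fromℕ-nonNeg : ∀ n → 0# ≤ fromℕ n
  fromℕ-nonNeg zero    = ≤-refl
  fromℕ-nonNeg (suc n) = subst (_≤ fromℕ (suc n)) (+-identityˡ 0#) (+-mono-≤ 0≤1 (fromℕ-nonNeg n))

  fromℕ-nonZero : ∀ n .{{_ : NonZero n}} → ¬ (fromℕ n ≡ 0#)
  fromℕ-nonZero (suc n) 1+n≡0 =
    ¬1≤0 (subst₂ _≤_ (+-identityʳ 1#) 1+n≡0 (+-monoʳ-≤ 1# (fromℕ-nonNeg n)))

  sumTo-cong : ∀ {f g} n → (∀ m → m ℕ.< n → f m ≡ g m) → sumTo f n ≡ sumTo g n
  sumTo-cong zero    _   = refl
  sumTo-cong (suc n) f≗g = cong₂ _+_ (sumTo-cong n (λ m m<n → f≗g m (ℕₚ.m<n⇒m<1+n m<n))) (f≗g n ℕₚ.≤-refl)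

  sumTo-+ : ∀ f m n → sumTo f (m ℕ.+ n) ≡ sumTo f m + sumTo (λ t → f (m ℕ.+ t)) n
  sumTo-+ f m zero    rewrite ℕₚ.+-identityʳ m = sym (+-identityʳ (sumTo f m))
  sumTo-+ f m (suc n) rewrite ℕₚ.+-suc m n =
    trans (cong (_+ f (m ℕ.+ n)) (sumTo-+ f m n)) (+-assoc (sumTo f m) _ _)

  sumTo-*ˡ : ∀ c f n → sumTo (λ m → c * f m) n ≡ c * sumTo f n
  sumTo-*ˡ c f zero    = sym (zeroʳ c)
  sumTo-*ˡ c f (suc n) = trans (cong (_+ c * f n) (sumTo-*ˡ c f n)) (sym (distribˡ c (sumTo f n) (f n)))

  sumTo-const : ∀ c n → sumTo (λ _ → c) n ≡ fromℕ n * c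
  sumTo-const c zero    = sym (zeroˡ c)
  sumTo-const c (suc n) = begin
    sumTo (λ _ → c) n + c   ≡⟨ cong (_+ c) (sumTo-const c n) ⟩
    fromℕ n * c + c         ≡⟨ +-comm (fromℕ n * c) c ⟩
    c + fromℕ n * c         ≡⟨ cong (_+ fromℕ n * c) (*-identityˡ c) ⟨
    1# * c + fromℕ n * c    ≡⟨ distribʳ c 1# (fromℕ n) ⟨
    (1# + fromℕ n) * c      ∎
    where open ≡-Reasoning

  sumTo-zero : ∀ {f} n → (∀ m → m ℕ.< n → f m ≡ 0#) → sumTo f n ≡ 0#
  sumTo-zero zero    _  = refl
  sumTo-zero (suc n) f≡0 =
    trans (cong₂ _+_ (sumTo-zero n (λ m m<n → f≡0 m (ℕₚ.m<n⇒m<1+n m<n))) (f≡0 n ℕₚ.≤-refl)) (+-identityʳ 0#)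

  sumTo-nonNeg : ∀ {f} n → (∀ m → 0# ≤ f m) → 0# ≤ sumTo f n
  sumTo-nonNeg zero    _   = ≤-refl
  sumTo-nonNeg {f} (suc n) f≥0 =
    subst (_≤ sumTo f (suc n)) (+-identityʳ 0#) (+-mono-≤ (sumTo-nonNeg n f≥0) (f≥0 n))

  sumTo-vanishing : ∀ {f m n} → (∀ t → m ℕ.≤ t → f t ≡ 0#) → m ℕ.≤ n → sumTo f n ≡ sumTo f m
  sumTo-vanishing {f} {m} {n} f≡0 m≤n = begin
    sumTo f n                                   ≡⟨ cong (sumTo f) (ℕₚ.m+[n∸m]≡n m≤n) ⟨
    sumTo f (m ℕ.+ (n ℕ.∸ m))                   ≡⟨ sumTo-+ f m (n ℕ.∸ m) ⟩
    sumTo f m + sumTo (λ t → f (m ℕ.+ t)) (n ℕ.∸ m)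
      ≡⟨ cong (sumTo f m +_) (sumTo-zero (n ℕ.∸ m) (λ t _ → f≡0 (m ℕ.+ t) (ℕₚ.m≤m+n m t))) ⟩
    sumTo f m + 0#                              ≡⟨ +-identityʳ (sumTo f m) ⟩
    sumTo f m                                   ∎
    where open ≡-Reasoning

  sumTo-blocks : ∀ f n q → sumTo f (q ℕ.* n) ≡ sumTo (λ p → sumTo (λ t → f (p ℕ.* n ℕ.+ t)) n) q
  sumTo-blocks f n zero    = refl
  sumTo-blocks f n (suc q) = begin
    sumTo f (n ℕ.+ q ℕ.* n)                                  ≡⟨ cong (sumTo f) (ℕₚ.+-comm n (q ℕ.* n)) ⟩
    sumTo f (q ℕ.* n ℕ.+ n)                                  ≡⟨ sumTo-+ f (q ℕ.* n) n ⟩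
    sumTo f (q ℕ.* n) + block q                              ≡⟨ cong (_+ block q) (sumTo-blocks f n q) ⟩
    sumTo block q + block q                                  ∎
    where
    open ≡-Reasoning
    block : ℕ → Carrier
    block p = sumTo (λ t → f (p ℕ.* n ℕ.+ t)) n

  total≡sumTo : ∀ (s : Seq ℝ) {n} → (∀ m → n ℕ.≤ m → proj₁ s m ≡ 0#) → total ℝ s ≡ sumTo (proj₁ s) n
  total≡sumTo (x , b , x≡0) {n} x≡0' with ℕₚ.≤-total b n
  ... | inj₁ b≤n = sym (sumTo-vanishing x≡0 b≤n)
  ... | inj₂ n≤b = sumTo-vanishing x≡0' n≤b

  r : ℕ → ℕ → ℕ → Carrier
  r i j k = fromℕ (i ℕ.+ j) - fromℕ k

  fromℕ-*-r : ∀ N i j k → fromℕ N * r i j k ≡ r (N ℕ.* i) (N ℕ.* j) (N ℕ.* k)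
  fromℕ-*-r N i j k = begin
    fromℕ N * (fromℕ (i ℕ.+ j) - fromℕ k)                ≡⟨ x[y-z]≈xy-xz (fromℕ N) (fromℕ (i ℕ.+ j)) (fromℕ k) ⟩
    fromℕ N * fromℕ (i ℕ.+ j) - fromℕ N * fromℕ k         ≡⟨ cong₂ _-_ (fromℕ-* N (i ℕ.+ j)) (fromℕ-* N k) ⟨
    fromℕ (N ℕ.* (i ℕ.+ j)) - fromℕ (N ℕ.* k)             ≡⟨ cong (λ n → fromℕ n - fromℕ (N ℕ.* k)) (ℕₚ.*-distribˡ-+ N i j) ⟩
    fromℕ (N ℕ.* i ℕ.+ N ℕ.* j) - fromℕ (N ℕ.* k)         ∎
    where open ≡-Reasoning

  *-inverse-cancelˡ : ∀ {a c} w → a * c ≡ 1# → c * (a * w) ≡ w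
  *-inverse-cancelˡ {a} {c} w ac≡1 = begin
    c * (a * w)   ≡⟨ *-assoc c a w ⟨
    c * a * w     ≡⟨ cong (_* w) (trans (*-comm c a) ac≡1) ⟩
    1# * w        ≡⟨ *-identityˡ w ⟩
    w             ∎
    where open ≡-Reasoning

  PrefixBounded : (ℕ → Carrier) → ℕ → Set
  PrefixBounded x i = ∀ ℓ → ℓ ℕ.≤ i → sumTo x ℓ ≤ fromℕ ℓ

  prefixBounded : ∀ {x i} → (∀ ℓ → 1 ℕ.≤ ℓ → ℓ ℕ.≤ i → sumTo x ℓ ≤ fromℕ ℓ) → PrefixBounded x i
  prefixBounded _          zero    _   = ≤-refl
  prefixBounded x-bounded (suc ℓ) ℓ<i = x-bounded (suc ℓ) (ℕ.s≤s ℕ.z≤n) ℓ<i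

  interpolate-≤ : ∀ {S x} q {s d N} → s ℕ.+ d ≡ N → S ≤ fromℕ q → (0 ℕ.< s → S + x ≤ fromℕ (suc q)) →
                  fromℕ N * S + fromℕ s * x ≤ fromℕ (q ℕ.* N ℕ.+ s)
  interpolate-≤ {S} {x} q {s} {d} refl S≤q S+x≤1+q = begin
    fromℕ (s ℕ.+ d) * S + fromℕ s * x               ≡⟨ cong (λ a → a * S + fromℕ s * x) (fromℕ-+ s d) ⟩
    (fromℕ s + fromℕ d) * S + fromℕ s * x           ≡⟨ regroup (fromℕ s) (fromℕ d) S x ⟩
    fromℕ d * S + fromℕ s * (S + x)                 ≤⟨ +-mono-≤ (*-monoʳ-≤-nonNeg (fromℕ-nonNeg d) S≤q) (s-part s S+x≤1+q) ⟩
    fromℕ d * fromℕ q + fromℕ s * fromℕ (suc q)     ≡⟨ cong₂ _+_ (fromℕ-* d q) (fromℕ-* s (suc q)) ⟨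
    fromℕ (d ℕ.* q) + fromℕ (s ℕ.* suc q)           ≡⟨ fromℕ-+ (d ℕ.* q) (s ℕ.* suc q) ⟨
    fromℕ (d ℕ.* q ℕ.+ s ℕ.* suc q)                 ≡⟨ cong fromℕ (rearrange q s d) ⟩
    fromℕ (q ℕ.* (s ℕ.+ d) ℕ.+ s)                   ∎
    where
    open ≤-Reasoning
    rearrange : ∀ q s d → d ℕ.* q ℕ.+ s ℕ.* suc q ≡ q ℕ.* (s ℕ.+ d) ℕ.+ s
    rearrange = ℕ-Solver.solve-∀
    regroup : ∀ s d S x → (s + d) * S + s * x ≡ d * S + s * (S + x)
    regroup = solve 4 (λ s d S x → ((s ⊕ d) ⊗ S ⊕ s ⊗ x) ⊜ (d ⊗ S ⊕ s ⊗ (S ⊕ x))) refl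
    s-part : ∀ s → (0 ℕ.< s → S + x ≤ fromℕ (suc q)) → fromℕ s * (S + x) ≤ fromℕ s * fromℕ (suc q)
    s-part zero    _          = subst₂ _≤_ (sym (zeroˡ (S + x))) (sym (zeroˡ (fromℕ (suc q)))) ≤-refl
    s-part (suc s) S+x≤1+q    = *-monoʳ-≤-nonNeg (fromℕ-nonNeg (suc s)) (S+x≤1+q (ℕ.s≤s ℕ.z≤n))

  module _ (N : ℕ) .{{_ : NonZero N}} where

    stretch : (ℕ → Carrier) → ℕ → Carrier
    stretch x m = x (m / N)

    sumTo-stretch-block : ∀ x p {s} → s ℕ.≤ N → sumTo (λ t → stretch x (p ℕ.* N ℕ.+ t)) s ≡ fromℕ s * x p
    sumTo-stretch-block x p {s} s≤N =
      trans (sumTo-cong s (λ t t<s → cong x ([m*n+o]/n≡m p (ℕₚ.<-≤-trans t<s s≤N)))) (sumTo-const (x p) s)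

    sumTo-stretch-blocks : ∀ x q → sumTo (stretch x) (q ℕ.* N) ≡ fromℕ N * sumTo x q
    sumTo-stretch-blocks x q = begin
      sumTo (stretch x) (q ℕ.* N)                                   ≡⟨ sumTo-blocks (stretch x) N q ⟩
      sumTo (λ p → sumTo (λ t → stretch x (p ℕ.* N ℕ.+ t)) N) q     ≡⟨ sumTo-cong q (λ p _ → sumTo-stretch-block x p ℕₚ.≤-refl) ⟩
      sumTo (λ p → fromℕ N * x p) q                                 ≡⟨ sumTo-*ˡ (fromℕ N) x q ⟩
      fromℕ N * sumTo x q                                           ∎
      where open ≡-Reasoning

    sumTo-stretch : ∀ x q {s} → s ℕ.≤ N → sumTo (stretch x) (q ℕ.* N ℕ.+ s) ≡ fromℕ N * sumTo x q + fromℕ s * x q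
    sumTo-stretch x q {s} s≤N = trans (sumTo-+ (stretch x) (q ℕ.* N) s)
      (cong₂ _+_ (sumTo-stretch-blocks x q) (sumTo-stretch-block x q s≤N))

    stretch-vanishing : ∀ {x k} → (∀ p → k ℕ.≤ p → x p ≡ 0#) → ∀ m → k ℕ.* N ℕ.≤ m → stretch x m ≡ 0#
    stretch-vanishing {k = k} x≡0 m kN≤m = x≡0 (m / N) (m*n≤o⇒m≤o/n k kN≤m)

    stretch-prefixBounded : ∀ {x i} → PrefixBounded x i → PrefixBounded (stretch x) (i ℕ.* N)
    stretch-prefixBounded {x} {i} x-bounded ℓ ℓ≤iN =
      subst (λ n → sumTo (stretch x) n ≤ fromℕ n) (sym ℓ≡qN+s) (begin
        sumTo (stretch x) (q ℕ.* N ℕ.+ s)     ≡⟨ sumTo-stretch x q s≤N ⟩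
        fromℕ N * sumTo x q + fromℕ s * x q   ≤⟨ interpolate-≤ q (ℕₚ.m+[n∸m]≡n s≤N) (x-bounded q q≤i)
                                                   (λ 0<s → x-bounded (suc q) (q<i 0<s)) ⟩
        fromℕ (q ℕ.* N ℕ.+ s)                 ∎)
      where
      open ≤-Reasoning
      q s : ℕ
      q = ℓ / N
      s = ℓ % N
      s≤N : s ℕ.≤ N
      s≤N = ℕₚ.<⇒≤ (m%n<n ℓ N)
      ℓ≡qN+s : ℓ ≡ q ℕ.* N ℕ.+ s
      ℓ≡qN+s = trans (m≡m%n+[m/n]*n ℓ N) (ℕₚ.+-comm s (q ℕ.* N))
      q≤i : q ℕ.≤ i
      q≤i = ℕₚ.*-cancelʳ-≤ q i N (ℕₚ.≤-trans (m/n*n≤m ℓ N) ℓ≤iN)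
      q<i : 0 ℕ.< s → q ℕ.< i
      q<i 0<s = ℕₚ.*-cancelʳ-< N q i (ℕₚ.<-≤-trans (subst (q ℕ.* N ℕ.<_) (sym ℓ≡qN+s) (ℕₚ.m<m+n (q ℕ.* N) 0<s)) ℓ≤iN)

    π-image⇒scaled : ∀ i j k (y : Seq ℝ) → InImageπ ℝ N (Q ℝ (N ℕ.* k) (N ℕ.* i) (N ℕ.* j)) y →
                     InScaled ℝ N (Q ℝ k i j) y
    π-image⇒scaled i j k (y , _) (z@(zf , _) , (z≥0 , z-total , z-prefix , z-supp) , y≡πz) =
      (x , k , x-supp) , (x≥0 , x-total , x-prefix , x-supp) , y≡Nx
      where
      open ≤-Reasoning
      c : Carrier
      c = proj₁ (inverse (fromℕ N) (fromℕ-nonZero N))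
      Nc≡1 : fromℕ N * c ≡ 1#
      Nc≡1 = proj₂ (inverse (fromℕ N) (fromℕ-nonZero N))
      c≥0 : 0# ≤ c
      c≥0 = *-inverse-nonNeg (fromℕ-nonNeg N) Nc≡1
      x : ℕ → Carrier
      x p = c * y p
      y≡Nx : ∀ p → y p ≡ fromℕ N * x p
      y≡Nx p = begin-equality
        y p                      ≡⟨ *-identityˡ (y p) ⟨
        1# * y p                 ≡⟨ cong (_* y p) Nc≡1 ⟨
        fromℕ N * c * y p        ≡⟨ *-assoc (fromℕ N) c (y p) ⟩
        fromℕ N * (c * y p)      ∎
      z-supp′ : ∀ m → k ℕ.* N ℕ.≤ m → zf m ≡ 0#
      z-supp′ m kN≤m = z-supp m (subst (ℕ._≤ m) (ℕₚ.*-comm k N) kN≤m)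
      x-supp : ∀ p → k ℕ.≤ p → x p ≡ 0#
      x-supp p k≤p = trans (cong (c *_) (trans (y≡πz p) (sumTo-zero N block≡0))) (zeroʳ c)
        where
        block≡0 : ∀ t → t ℕ.< N → zf (p ℕ.* N ℕ.+ t) ≡ 0#
        block≡0 t _ = z-supp′ _ (ℕₚ.≤-trans (ℕₚ.*-monoˡ-≤ N k≤p) (ℕₚ.m≤m+n (p ℕ.* N) t))
      x≥0 : ∀ p → 0# ≤ x p
      x≥0 p = *-nonneg c≥0 (subst (0# ≤_) (sym (y≡πz p)) (sumTo-nonNeg N (λ t → z≥0 (p ℕ.* N ℕ.+ t))))
      sumTo-x : ∀ q → sumTo x q ≡ c * sumTo zf (q ℕ.* N)
      sumTo-x q = trans (sumTo-*ˡ c y q)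
        (cong (c *_) (trans (sumTo-cong q (λ p _ → y≡πz p)) (sym (sumTo-blocks zf N q))))
      x-total : sumTo x k ≡ r i j k
      x-total = begin-equality
        sumTo x k                                ≡⟨ sumTo-x k ⟩
        c * sumTo zf (k ℕ.* N)                   ≡⟨ cong (c *_) (total≡sumTo z z-supp′) ⟨
        c * total ℝ z                            ≡⟨ cong (c *_) (trans z-total (sym (fromℕ-*-r N i j k))) ⟩
        c * (fromℕ N * r i j k)                  ≡⟨ *-inverse-cancelˡ (r i j k) Nc≡1 ⟩
        r i j k                                  ∎
      x-prefix : ∀ ℓ → 1 ℕ.≤ ℓ → ℓ ℕ.≤ i → sumTo x ℓ ≤ fromℕ ℓ
      x-prefix ℓ 1≤ℓ ℓ≤i = begin
        sumTo x ℓ                                ≡⟨ sumTo-x ℓ ⟩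
        c * sumTo zf (ℓ ℕ.* N)                   ≤⟨ *-monoʳ-≤-nonNeg c≥0 (z-prefix (ℓ ℕ.* N) 1≤ℓN ℓN≤Ni) ⟩
        c * fromℕ (ℓ ℕ.* N)                      ≡⟨ cong (λ n → c * fromℕ n) (ℕₚ.*-comm ℓ N) ⟩
        c * fromℕ (N ℕ.* ℓ)                      ≡⟨ cong (c *_) (fromℕ-* N ℓ) ⟩
        c * (fromℕ N * fromℕ ℓ)                  ≡⟨ *-inverse-cancelˡ (fromℕ ℓ) Nc≡1 ⟩
        fromℕ ℓ                                  ∎
        where
        1≤ℓN : 1 ℕ.≤ ℓ ℕ.* N
        1≤ℓN = ℕₚ.≤-trans 1≤ℓ (ℕₚ.m≤m*n ℓ N)
        ℓN≤Ni : ℓ ℕ.* N ℕ.≤ N ℕ.* i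
        ℓN≤Ni = ℕₚ.≤-trans (ℕₚ.*-monoˡ-≤ N ℓ≤i) (ℕₚ.≤-reflexive (ℕₚ.*-comm i N))

    scaled⇒π-image : ∀ i j k (y : Seq ℝ) → InScaled ℝ N (Q ℝ k i j) y →
                     InImageπ ℝ N (Q ℝ (N ℕ.* k) (N ℕ.* i) (N ℕ.* j)) y
    scaled⇒π-image i j k (y , _) ((x , n , x-vanish) , (x≥0 , x-total , x-prefix , x-supp) , y≡Nx) =
      z , ((λ m → x≥0 (m / N)) , z-total , z-prefix , z-supp) , y≡πz
      where
      z : Seq ℝ
      z = stretch x , n ℕ.* N , stretch-vanishing x-vanish
      z-total : sumTo (stretch x) (n ℕ.* N) ≡ r (N ℕ.* i) (N ℕ.* j) (N ℕ.* k)
      z-total = trans (sumTo-stretch-blocks x n) (trans (cong (fromℕ N *_) x-total) (fromℕ-*-r N i j k))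
      z-prefix : ∀ ℓ → 1 ℕ.≤ ℓ → ℓ ℕ.≤ N ℕ.* i → sumTo (stretch x) ℓ ≤ fromℕ ℓ
      z-prefix ℓ _ ℓ≤Ni =
        stretch-prefixBounded (prefixBounded x-prefix) ℓ (subst (ℓ ℕ.≤_) (ℕₚ.*-comm N i) ℓ≤Ni)
      z-supp : ∀ m → N ℕ.* k ℕ.≤ m → stretch x m ≡ 0#
      z-supp m Nk≤m = stretch-vanishing x-supp m (subst (ℕ._≤ m) (ℕₚ.*-comm N k) Nk≤m)
      y≡πz : ∀ p → y p ≡ sumTo (λ t → stretch x (p ℕ.* N ℕ.+ t)) N
      y≡πz p = trans (y≡Nx p) (sym (sumTo-stretch-block x p ℕₚ.≤-refl))

open import Data.Nat using (ℕ; _*_; _≤_)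
open import Function.Bundles using (_⇔_)

lemma3p4 : (ℝ : RealField) (i j k N : ℕ) → 1 ≤ N → (y : Seq ℝ) →
    InImageπ ℝ N (Q ℝ (N * k) (N * i) (N * j)) y ⇔ InScaled ℝ N (Q ℝ k i j) y
lemma3p4 ℝ i j k N@(suc _) _ y = mk⇔ (π-image⇒scaled ℝ N i j k y) (scaled⇒π-image ℝ N i j k y)
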